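{- Let $k\ge 2$ be an integer and let $A\subseteq \mathbb{N}$ be a set such that $r_{1,k}(A,n)=r_{1,k}(\mathbb{N}\setminus A,n)$ for all sufficiently large integers $n$. Then $$\liminf_{n\to\infty}\frac{r_{1,k}(A,n)}{n}>0.$$
   Context: $\mathbb{N}$ denotes the set of all nonnegative integers. For a positive integer $k$, a subset $B\subseteq\mathbb{N}$ and a nonnegative integer $n$, $r_{1,k}(B,n)$ denotes the number of ordered pairs $(a_1,a_2)\in B\times B$ with $n=a_1+ka_2$. -}

module Defs where

open import Data.Nat using (ℕ; zero; suc; _+_; _*_; _∸_; _≤_; _≤ᵇ_)
open import Data.Bool using (Bool; true; false; not; _∧_; if_then_else_)
open import Data.List using (List; upTo; filterᵇ; length)

Subset : Set
Subset = ℕ → Bool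

complement : Subset → Subset
complement B n = not (B n)

-- r₁,ₖ(B,n) = #{(a₁,a₂) ∈ B × B : n = a₁ + k·a₂}.
-- For each a₂ with k·a₂ ≤ n, a₁ is uniquely n ∸ k·a₂; when k ≥ 1 every such
-- a₂ is ≤ n, so we range a₂ over 0..n.
r1k : ℕ → Subset → ℕ → ℕ
r1k k B n = length (filterᵇ (λ a₂ → ((k * a₂) ≤ᵇ n) ∧ B a₂ ∧ B (n ∸ k * a₂)) (upTo (suc n)))

{-# OPTIONS --safe #-}
module Submission where

-- Write n = kq + s with s < k. A representation n = a + kb has b ≤ q, and inclusion–exclusion over b ≤ q
-- shows that r(A, n) = r(ℕ ∖ A, n) says #{b ≤ q : b ∈ A} + #{b ≤ q : n − kb ∈ A} = q + 1. Comparing n with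
-- n + k gives the digit rule A(kd + j) = ¬A(d) for j < k and kd + j ≥ M. Under it, A can change value
-- between v and v + 1 only when k ∣ v + 1, and the change then descends to one between (v + 1)/k − 1 and
-- (v + 1)/k; hence changes at v and v + e force v + 1 ≤ Me. So A is not symmetric on [M, q − M]: for all
-- large q some a + c = q has exactly one of a, c in A. The digit rule multiplies such splittings (those of
-- Q + 1 and Q give s + 1 and k − 1 − s splittings of k(Q + 1) + s), so their number grows linearly in q,
-- and each splitting of q gives a representation of kq + s.

open import Defs
open import Data.Nat using (ℕ; zero; suc; _+_; _*_; _∸_; _≤_; _≥_; _<_; _≤ᵇ_; _≤?_; z≤n; s≤s; NonZero; >-nonZero; _/_; _%_)
open import Data.Nat.Properties
open import Data.Nat.DivMod using (m≡m%n+[m/n]*n; m%n<n)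
open import Data.Nat.Induction using (<-rec)
open import Data.Nat.Tactic.RingSolver using (solve-∀)
open import Algebra.Properties.CommutativeSemigroup +-commutativeSemigroup using () renaming (interchange to +-interchange)
open import Data.Bool using (Bool; true; false; not; _∧_; _xor_; T; T?)
open import Data.Bool.Properties as Bool using ()
open import Data.List using (filterᵇ; length; applyUpTo)
open import Data.Product using (_×_; _,_; proj₁; proj₂; ∃-syntax)
open import Data.Sum using (_⊎_; inj₁; inj₂)
open import Data.Unit using (tt)
open import Data.Empty using (⊥-elim)
open import Function using (_∘_; id; _⇔_; mk⇔; Equivalence)
open import Relation.Nullary using (¬_; Dec; yes; no)
open import Relation.Binary.PropositionalEquality using (_≡_; _≢_; refl; sym; trans; cong; cong₂; subst; module ≡-Reasoning)

𝟙 : Bool → ℕ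
𝟙 true  = 1
𝟙 false = 0

𝟙-mono : ∀ {x y} → (T x → T y) → 𝟙 x ≤ 𝟙 y
𝟙-mono {false} _ = z≤n
𝟙-mono {true} {true} _ = ≤-refl
𝟙-mono {true} {false} f = ⊥-elim (f tt)

𝟙-≡0 : ∀ {x} → ¬ T x → 𝟙 x ≡ 0
𝟙-≡0 {false} _ = refl
𝟙-≡0 {true}  f = ⊥-elim (f tt)

T-injective : ∀ {x y} → (T x → T y) → (T y → T x) → x ≡ y
T-injective {false} {false} _  _  = refl
T-injective {true}  {true}  _  _  = refl
T-injective {true}  {false} to _  = ⊥-elim (to tt)
T-injective {false} {true}  _  from = ⊥-elim (from tt)

𝟙-∧-inclusion-exclusion : ∀ x y → 𝟙 (x ∧ y) + 1 ≡ (𝟙 x + 𝟙 y) + 𝟙 (not x ∧ not y)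
𝟙-∧-inclusion-exclusion true  true  = refl
𝟙-∧-inclusion-exclusion true  false = refl
𝟙-∧-inclusion-exclusion false true  = refl
𝟙-∧-inclusion-exclusion false false = refl

xor⇒≢ : ∀ {x y} → T (x xor y) → x ≢ y
xor⇒≢ {true}  {false} _ ()
xor⇒≢ {false} {true}  _ ()

≢⇒xor : ∀ {x y} → x ≢ y → T (x xor y)
≢⇒xor {true}  {true}  x≢y = x≢y refl
≢⇒xor {true}  {false} _   = tt
≢⇒xor {false} {true}  _   = tt
≢⇒xor {false} {false} x≢y = x≢y refl

≢⇒T⊎T : ∀ {x y} → x ≢ y → T x ⊎ T y
≢⇒T⊎T {true}  _   = inj₁ tt
≢⇒T⊎T {false} {true}  _   = inj₂ tt
≢⇒T⊎T {false} {false} x≢y = ⊥-elim (x≢y refl)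

𝟙+𝟙≡1⇒≡not : ∀ x y → 𝟙 x + 𝟙 y ≡ 1 → y ≡ not x
𝟙+𝟙≡1⇒≡not true  false _ = refl
𝟙+𝟙≡1⇒≡not false true  _ = refl

∑ : ℕ → (ℕ → ℕ) → ℕ
∑ zero    f = 0
∑ (suc n) f = f 0 + ∑ n (f ∘ suc)

syntax ∑ n (λ a → e) = ∑[ a < n ] e

length-filterᵇ-applyUpTo : ∀ (p : ℕ → Bool) (f : ℕ → ℕ) n →
  length (filterᵇ p (applyUpTo f n)) ≡ ∑[ a < n ] 𝟙 (p (f a))
length-filterᵇ-applyUpTo p f zero = refl
length-filterᵇ-applyUpTo p f (suc n) with p (f 0)
... | true  = cong suc (length-filterᵇ-applyUpTo p (f ∘ suc) n)
... | false = length-filterᵇ-applyUpTo p (f ∘ suc) n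

∑-cong : ∀ {f g} n → (∀ a → a < n → f a ≡ g a) → ∑ n f ≡ ∑ n g
∑-cong zero    _  = refl
∑-cong (suc n) eq = cong₂ _+_ (eq 0 (s≤s z≤n)) (∑-cong n (λ a a<n → eq (suc a) (s≤s a<n)))

∑-mono-≤ : ∀ {f g} n → (∀ a → a < n → f a ≤ g a) → ∑ n f ≤ ∑ n g
∑-mono-≤ zero    _  = z≤n
∑-mono-≤ (suc n) le = +-mono-≤ (le 0 (s≤s z≤n)) (∑-mono-≤ n (λ a a<n → le (suc a) (s≤s a<n)))

∑-distrib-+ : ∀ f g n → ∑[ a < n ] (f a + g a) ≡ ∑ n f + ∑ n g
∑-distrib-+ f g zero    = refl
∑-distrib-+ f g (suc n) rewrite ∑-distrib-+ (f ∘ suc) (g ∘ suc) n =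
  +-interchange (f 0) (g 0) (∑ n (f ∘ suc)) (∑ n (g ∘ suc))

∑-*ˡ : ∀ c f n → ∑[ a < n ] (c * f a) ≡ c * ∑ n f
∑-*ˡ c f zero    = sym (*-zeroʳ c)
∑-*ˡ c f (suc n) rewrite ∑-*ˡ c (f ∘ suc) n = sym (*-distribˡ-+ c (f 0) (∑ n (f ∘ suc)))

∑-const : ∀ c n → ∑[ _ < n ] c ≡ n * c
∑-const c zero    = refl
∑-const c (suc n) = cong (c +_) (∑-const c n)

∑-++ : ∀ f m n → ∑ (m + n) f ≡ ∑ m f + ∑[ a < n ] f (m + a)
∑-++ f zero    n = refl
∑-++ f (suc m) n rewrite ∑-++ (f ∘ suc) m n = sym (+-assoc (f 0) (∑ m (f ∘ suc)) _)

∑-snoc : ∀ f n → ∑ (suc n) f ≡ ∑ n f + f n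
∑-snoc f n = begin
  ∑ (suc n) f                 ≡⟨ cong (λ m → ∑ m f) (+-comm 1 n) ⟩
  ∑ (n + 1) f                 ≡⟨ ∑-++ f n 1 ⟩
  ∑ n f + (f (n + 0) + 0)     ≡⟨ cong (∑ n f +_) (trans (+-identityʳ _) (cong f (+-identityʳ n))) ⟩
  ∑ n f + f n                 ∎
  where open ≡-Reasoning

∑-mono-range : ∀ f {m n} → m ≤ n → ∑ m f ≤ ∑ n f
∑-mono-range f {m} m≤n with m≤n⇒∃[o]m+o≡n m≤n
... | o , refl = subst (∑ m f ≤_) (sym (∑-++ f m o)) (m≤m+n (∑ m f) _)

∑-cut : ∀ f {m n} → m ≤ n → (∀ a → m ≤ a → a < n → f a ≡ 0) → ∑ n f ≡ ∑ m f
∑-cut f {m} m≤n zero-tail with m≤n⇒∃[o]m+o≡n m≤n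
... | o , refl = begin
  ∑ (m + o) f                     ≡⟨ ∑-++ f m o ⟩
  ∑ m f + ∑[ a < o ] f (m + a)    ≡⟨ cong (∑ m f +_) (∑-cong o (λ a a<o → zero-tail (m + a) (m≤m+n m a) (+-monoʳ-< m a<o))) ⟩
  ∑ m f + ∑[ _ < o ] 0            ≡⟨ cong (∑ m f +_) (∑-const 0 o) ⟩
  ∑ m f + o * 0                   ≡⟨ cong (∑ m f +_) (*-zeroʳ o) ⟩
  ∑ m f + 0                       ≡⟨ +-identityʳ _ ⟩
  ∑ m f                           ∎
  where open ≡-Reasoning

∑-positive : ∀ f {n} a → a < n → 1 ≤ f a → 1 ≤ ∑ n f
∑-positive f zero    (s≤s _)   1≤fa = ≤-trans 1≤fa (m≤m+n _ _)
∑-positive f (suc a) (s≤s a<n) 1≤fa = ≤-trans (∑-positive (f ∘ suc) a a<n 1≤fa) (m≤n+m _ _)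

∑-blocks : ∀ f k N → ∑ (k * N) f ≡ ∑[ z < N ] ∑[ j < k ] f (k * z + j)
∑-blocks f k zero    = cong (λ m → ∑ m f) (*-zeroʳ k)
∑-blocks f k (suc N) = begin
  ∑ (k * suc N) f                                    ≡⟨ cong (λ m → ∑ m f) (*-suc k N) ⟩
  ∑ (k + k * N) f                                    ≡⟨ ∑-++ f k (k * N) ⟩
  ∑ k f + ∑[ a < k * N ] f (k + a)                   ≡⟨ cong₂ _+_ (∑-cong k (λ j _ → cong (λ b → f (b + j)) (sym (*-zeroʳ k))))
                                                               (∑-blocks (λ a → f (k + a)) k N) ⟩
  ∑[ j < k ] f (k * 0 + j) + ∑[ z < N ] ∑[ j < k ] f (k + (k * z + j))
                                                     ≡⟨ cong (∑[ j < k ] f (k * 0 + j) +_)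
                                                          (∑-cong N (λ z _ → ∑-cong k (λ j _ → cong f (next-block z j)))) ⟩
  ∑[ j < k ] f (k * 0 + j) + ∑[ z < N ] ∑[ j < k ] f (k * suc z + j)  ∎
  where
  open ≡-Reasoning
  next-block : ∀ z j → k + (k * z + j) ≡ k * suc z + j
  next-block z j = trans (sym (+-assoc k (k * z) j)) (cong (_+ j) (sym (*-suc k z)))

∑-reverse : ∀ f q → ∑[ a < suc q ] f (q ∸ a) ≡ ∑ (suc q) f
∑-reverse f zero    = refl
∑-reverse f (suc q) = begin
  f (suc q) + ∑[ a < suc q ] f (q ∸ a)   ≡⟨ cong (f (suc q) +_) (∑-reverse f q) ⟩
  f (suc q) + ∑ (suc q) f                ≡⟨ +-comm (f (suc q)) _ ⟩
  ∑ (suc q) f + f (suc q)                ≡⟨ sym (∑-snoc f (suc q)) ⟩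
  ∑ (suc (suc q)) f                      ∎
  where open ≡-Reasoning

module _ {k s : ℕ} (s<k : s < k) where

  *-≤-digit : ∀ {a q} → a ≤ q → k * a ≤ k * q + s
  *-≤-digit a≤q = ≤-trans (*-monoʳ-≤ k a≤q) (m≤m+n _ s)

  *-<-digit : ∀ {a q} → q < a → k * q + s < k * a
  *-<-digit {a} {q} q<a = begin-strict
    k * q + s   <⟨ +-monoʳ-< (k * q) s<k ⟩
    k * q + k   ≡⟨ +-comm (k * q) k ⟩
    k + k * q   ≡⟨ *-suc k q ⟨
    k * suc q   ≤⟨ *-monoʳ-≤ k q<a ⟩
    k * a       ∎
    where open ≤-Reasoning

  *-≤ᵇ-digit : ∀ a q → (k * a ≤ᵇ k * q + s) ≡ (a ≤ᵇ q)
  *-≤ᵇ-digit a q = T-injective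
    (λ t → ≤⇒≤ᵇ (≮⇒≥ λ q<a → <⇒≱ (*-<-digit q<a) (≤ᵇ⇒≤ _ _ t)))
    (λ t → ≤⇒≤ᵇ (*-≤-digit (≤ᵇ⇒≤ a q t)))

  r1k-digits : ∀ (B : Subset) q →
    r1k k B (k * q + s) ≡ ∑[ a < suc q ] 𝟙 (B a ∧ B (k * q + s ∸ k * a))
  r1k-digits B q = begin
    r1k k B n                                    ≡⟨ length-filterᵇ-applyUpTo (λ a → (k * a ≤ᵇ n) ∧ P a) id (suc n) ⟩
    ∑[ a < suc n ] 𝟙 ((k * a ≤ᵇ n) ∧ P a)        ≡⟨ ∑-cong (suc n) (λ a _ → cong (λ b → 𝟙 (b ∧ P a)) (*-≤ᵇ-digit a q)) ⟩
    ∑[ a < suc n ] 𝟙 ((a ≤ᵇ q) ∧ P a)            ≡⟨ ∑-cut _ (s≤s q≤n) (λ a q<a _ → cong (λ b → 𝟙 (b ∧ P a)) (below-q q<a)) ⟩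
    ∑[ a < suc q ] 𝟙 ((a ≤ᵇ q) ∧ P a)            ≡⟨ ∑-cong (suc q) (λ a a<1+q → cong (λ b → 𝟙 (b ∧ P a)) (above-q a<1+q)) ⟩
    ∑[ a < suc q ] 𝟙 (P a)                       ∎
    where
    open ≡-Reasoning
    n = k * q + s
    P : ℕ → Bool
    P a = B a ∧ B (n ∸ k * a)
    q≤n : q ≤ n
    q≤n = ≤-trans (m≤n*m q k {{>-nonZero (≤-<-trans z≤n s<k)}}) (m≤m+n (k * q) s)
    below-q : ∀ {a} → q < a → (a ≤ᵇ q) ≡ false
    below-q q<a = T-injective (λ t → <⇒≱ q<a (≤ᵇ⇒≤ _ _ t)) λ ()
    above-q : ∀ {a} → a < suc q → (a ≤ᵇ q) ≡ true
    above-q a<1+q = T-injective (λ _ → tt) (λ _ → ≤⇒≤ᵇ (≤-pred a<1+q))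

  marginals : Subset → ℕ → ℕ
  marginals A q = ∑[ a < suc q ] 𝟙 (A a) + ∑[ a < suc q ] 𝟙 (A (k * q + s ∸ k * a))

  r1k-inclusion-exclusion : ∀ A q →
    r1k k A (k * q + s) + suc q ≡ marginals A q + r1k k (complement A) (k * q + s)
  r1k-inclusion-exclusion A q = begin
    r1k k A n + suc q                                ≡⟨ cong₂ _+_ (r1k-digits A q) (sym (trans (∑-const 1 (suc q)) (*-identityʳ _))) ⟩
    ∑[ a < suc q ] 𝟙 (x a ∧ y a) + ∑[ _ < suc q ] 1  ≡⟨ ∑-distrib-+ (λ a → 𝟙 (x a ∧ y a)) (λ _ → 1) (suc q) ⟨
    ∑[ a < suc q ] (𝟙 (x a ∧ y a) + 1)               ≡⟨ ∑-cong (suc q) (λ a _ → 𝟙-∧-inclusion-exclusion (x a) (y a)) ⟩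
    ∑[ a < suc q ] ((𝟙 (x a) + 𝟙 (y a)) + 𝟙 (not (x a) ∧ not (y a)))
                                                     ≡⟨ ∑-distrib-+ (λ a → 𝟙 (x a) + 𝟙 (y a)) (λ a → 𝟙 (not (x a) ∧ not (y a))) (suc q) ⟩
    ∑[ a < suc q ] (𝟙 (x a) + 𝟙 (y a)) + ∑[ a < suc q ] 𝟙 (not (x a) ∧ not (y a))
                                                     ≡⟨ cong₂ _+_ (∑-distrib-+ (𝟙 ∘ x) (𝟙 ∘ y) (suc q)) (sym (r1k-digits (complement A) q)) ⟩
    marginals A q + r1k k (complement A) n           ∎
    where
    open ≡-Reasoning
    n = k * q + s
    x y : ℕ → Bool
    x a = A a
    y a = A (n ∸ k * a)

  marginals-suc : ∀ A q → marginals A (suc q) ≡ marginals A q + (𝟙 (A (suc q)) + 𝟙 (A (k * suc q + s)))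
  marginals-suc A q = begin
    ∑[ a < suc (suc q) ] 𝟙 (A a) + (𝟙 (A (n′ ∸ k * 0)) + ∑[ a < suc q ] 𝟙 (A (n′ ∸ k * suc a)))
        ≡⟨ cong₂ _+_ (∑-snoc (𝟙 ∘ A) (suc q))
                     (cong₂ _+_ (cong (λ m → 𝟙 (A (n′ ∸ m))) (*-zeroʳ k))
                                (∑-cong (suc q) (λ a _ → cong (𝟙 ∘ A) (shift a)))) ⟩
    (∑[ a < suc q ] 𝟙 (A a) + 𝟙 (A (suc q))) + (𝟙 (A n′) + ∑[ a < suc q ] 𝟙 (A (n ∸ k * a)))
        ≡⟨ cong ((∑[ a < suc q ] 𝟙 (A a) + 𝟙 (A (suc q))) +_) (+-comm (𝟙 (A n′)) _) ⟩
    (∑[ a < suc q ] 𝟙 (A a) + 𝟙 (A (suc q))) + (∑[ a < suc q ] 𝟙 (A (n ∸ k * a)) + 𝟙 (A n′))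
        ≡⟨ +-interchange (∑[ a < suc q ] 𝟙 (A a)) (𝟙 (A (suc q))) _ (𝟙 (A n′)) ⟩
    marginals A q + (𝟙 (A (suc q)) + 𝟙 (A n′)) ∎
    where
    open ≡-Reasoning
    n = k * q + s
    n′ = k * suc q + s
    shift : ∀ a → n′ ∸ k * suc a ≡ n ∸ k * a
    shift a = begin
      k * suc q + s ∸ k * suc a      ≡⟨ cong₂ (λ u v → u + s ∸ v) (*-suc k q) (*-suc k a) ⟩
      k + k * q + s ∸ (k + k * a)    ≡⟨ cong (_∸ (k + k * a)) (+-assoc k (k * q) s) ⟩
      k + (k * q + s) ∸ (k + k * a)  ≡⟨ [m+n]∸[m+o]≡n∸o k n (k * a) ⟩
      n ∸ k * a                      ∎

  marginals-balanced : ∀ A q → r1k k A (k * q + s) ≡ r1k k (complement A) (k * q + s) → marginals A q ≡ suc q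
  marginals-balanced A q balanced = sym (+-cancelˡ-≡ (r1k k A n) (suc q) (marginals A q) (begin
    r1k k A n + suc q                      ≡⟨ r1k-inclusion-exclusion A q ⟩
    marginals A q + r1k k (complement A) n ≡⟨ cong (marginals A q +_) balanced ⟨
    marginals A q + r1k k A n              ≡⟨ +-comm (marginals A q) _ ⟩
    r1k k A n + marginals A q              ∎))
    where
    open ≡-Reasoning
    n = k * q + s

DigitRule : ℕ → Subset → ℕ → Set
DigitRule k A M = ∀ d j → j < k → M ≤ k * d + j → A (k * d + j) ≡ not (A d)

balanced⇒digit-rule : ∀ {k} A N₀ → (∀ n → n ≥ N₀ → r1k k A n ≡ r1k k (complement A) n) → DigitRule k A (N₀ + k)
balanced⇒digit-rule {k} A N₀ balanced zero j j<k large =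
  ⊥-elim (<⇒≱ (subst (_< k) (sym (cong (_+ j) (*-zeroʳ k))) j<k) (≤-trans (m≤n+m k N₀) large))
balanced⇒digit-rule {k} A N₀ balanced (suc q) j j<k large =
  𝟙+𝟙≡1⇒≡not (A (suc q)) (A (k * suc q + j)) (+-cancelˡ-≡ (suc q) _ 1 increment)
  where
  N₀≤n : N₀ ≤ k * q + j
  N₀≤n = +-cancelʳ-≤ k N₀ (k * q + j) (begin
    N₀ + k           ≤⟨ large ⟩
    k * suc q + j    ≡⟨ cong (_+ j) (*-suc k q) ⟩
    k + k * q + j    ≡⟨ +-assoc k (k * q) j ⟩
    k + (k * q + j)  ≡⟨ +-comm k _ ⟩
    k * q + j + k    ∎)
    where open ≤-Reasoning
  increment : suc q + (𝟙 (A (suc q)) + 𝟙 (A (k * suc q + j))) ≡ suc q + 1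
  increment = begin
    suc q + (𝟙 (A (suc q)) + 𝟙 (A (k * suc q + j)))   ≡⟨ cong (_+ (𝟙 (A (suc q)) + 𝟙 (A (k * suc q + j)))) (marginals-balanced j<k A q (balanced _ N₀≤n)) ⟨
    marginals j<k A q + (𝟙 (A (suc q)) + 𝟙 (A (k * suc q + j)))
                                                       ≡⟨ marginals-suc j<k A q ⟨
    marginals j<k A (suc q)                            ≡⟨ marginals-balanced j<k A (suc q) (balanced _ (≤-trans (m≤m+n N₀ k) large)) ⟩
    suc (suc q)                                        ≡⟨ +-comm 1 (suc q) ⟩
    suc q + 1                                          ∎
    where open ≡-Reasoning

change-between : ∀ (f : ℕ → Bool) a d → f a ≢ f (a + d) → ∃[ v ] (a ≤ v × f (suc v) ≢ f v)
change-between f a zero    f≢ = ⊥-elim (f≢ (cong f (sym (+-identityʳ a))))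
change-between f a (suc d) f≢ with f (a + d) Bool.≟ f a
... | yes same = a + d , m≤m+n a d , λ eq → f≢ (trans (sym same) (trans (sym eq) (cong f (sym (+-suc a d)))))
... | no  diff = change-between f a d (diff ∘ sym)

module _ {k : ℕ} .{{_ : NonZero k}} where

  divide : ∀ n → ∃[ q ] ∃[ s ] (s < k × n ≡ k * q + s)
  divide n = n / k , n % k , m%n<n n k , trans (m≡m%n+[m/n]*n n k) (trans (+-comm (n % k) _) (cong (_+ n % k) (*-comm (n / k) k)))

  digitwise⇒linear : ∀ (r : ℕ → ℕ) C R → (∀ q s → s < k → R ≤ q → suc q ≤ C * r (k * q + s)) →
    ∀ n → k * R ≤ n → n ≤ k * C * r n
  digitwise⇒linear r C R bound n kR≤n with divide n
  ... | q , s , s<k , refl = begin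
    k * q + s             ≤⟨ <⇒≤ (*-<-digit s<k (n<1+n q)) ⟩
    k * suc q             ≤⟨ *-monoʳ-≤ k (bound q s s<k R≤q) ⟩
    k * (C * r (k * q + s)) ≡⟨ *-assoc k C _ ⟨
    k * C * r (k * q + s)   ∎
    where
    open ≤-Reasoning
    R≤q : R ≤ q
    R≤q = ≮⇒≥ λ q<R → <⇒≱ (*-<-digit s<k q<R) kR≤n

  linear-growth : 2 ≤ k → ∀ (g : ℕ → ℕ) R → (∀ q → R ≤ q → 1 ≤ g q) →
    (∀ Q s t → suc s + t ≡ k → suc s * g (suc Q) + t * g Q ≤ g (k * suc Q + s)) →
    ∀ q → R ≤ q → suc q ≤ k * suc R * g q
  linear-growth k≥2 g R positive recurrence = <-rec _ step
    where
    -- Below C the bound holds since g q ≥ 1; above it q = k(Q + 1) + s with R ≤ Q.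
    C = k * suc R
    step : ∀ q → (∀ {p} → p < q → R ≤ p → suc p ≤ C * g p) → R ≤ q → suc q ≤ C * g q
    step q ih R≤q with suc q ≤? C | divide q
    ... | yes small | _ = ≤-trans small (m≤m*n C (g q) {{>-nonZero (positive q R≤q)}})
    ... | no large | zero , s , s<k , refl =
      ⊥-elim (large (≤-trans (subst (_≤ k) (sym (cong suc (cong (_+ s) (*-zeroʳ k)))) s<k) (m≤m*n k (suc R))))
    ... | no large | suc Q , s , s<k , refl = begin
      suc (k * suc Q + s)                              ≡⟨ +-suc (k * suc Q) s ⟨
      k * suc Q + suc s                                ≡⟨ cong (λ k′ → k′ * suc Q + suc s) t-split ⟨
      (suc s + t) * suc Q + suc s                      ≡⟨ regroup (suc s) t Q ⟩
      suc s * suc (suc Q) + t * suc Q                  ≤⟨ +-mono-≤ (*-monoʳ-≤ (suc s) (ih Q+1<q R≤Q+1)) (*-monoʳ-≤ t (ih Q<q R≤Q)) ⟩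
      suc s * (C * g (suc Q)) + t * (C * g Q)          ≡⟨ pull-out C (suc s) t (g (suc Q)) (g Q) ⟩
      C * (suc s * g (suc Q) + t * g Q)                ≤⟨ *-monoʳ-≤ C (recurrence Q s t t-split) ⟩
      C * g (k * suc Q + s)                            ∎
      where
      open ≤-Reasoning
      t = k ∸ suc s
      t-split : suc s + t ≡ k
      t-split = m+[n∸m]≡n s<k
      R<1+Q : R < suc Q
      R<1+Q = ≤-pred (*-cancelˡ-< k (suc R) (suc (suc Q)) (≤-<-trans (≤-pred (≰⇒> large)) (*-<-digit s<k (n<1+n (suc Q)))))
      R≤Q+1 : R ≤ suc Q
      R≤Q+1 = <⇒≤ R<1+Q
      R≤Q : R ≤ Q
      R≤Q = ≤-pred R<1+Q
      Q+1<q : suc Q < k * suc Q + s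
      Q+1<q = <-≤-trans (subst (suc Q <_) (*-comm (suc Q) k) (m<m*n (suc Q) k k≥2)) (m≤m+n _ s)
      Q<q : Q < k * suc Q + s
      Q<q = <-trans (n<1+n Q) Q+1<q
      regroup : ∀ a t Q → (a + t) * suc Q + a ≡ a * suc (suc Q) + t * suc Q
      regroup = solve-∀
      pull-out : ∀ C a t x y → a * (C * x) + t * (C * y) ≡ C * (a * x + t * y)
      pull-out = solve-∀

module DigitRuleConsequences {k : ℕ} (k≥2 : 2 ≤ k) {A : Subset} {M : ℕ} (M≥1 : 1 ≤ M) (rule : DigitRule k A M) where

  private
    k≥1 : 1 ≤ k
    k≥1 = ≤-trans (s≤s z≤n) k≥2
    instance
      k-nonZero : NonZero k
      k-nonZero = >-nonZero k≥1

  rule-at : ∀ {n d j} → n ≡ k * d + j → j < k → M ≤ n → A n ≡ not (A d)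
  rule-at {d = d} {j} refl j<k = rule d j j<k

  last-digit : ∀ d → suc (k * d + (k ∸ 1)) ≡ k * suc d + 0
  last-digit d = begin
    suc (k * d + (k ∸ 1))   ≡⟨ +-suc (k * d) (k ∸ 1) ⟨
    k * d + suc (k ∸ 1)     ≡⟨ cong (k * d +_) (m+[n∸m]≡n {1} k≥1) ⟩
    k * d + k               ≡⟨ +-comm (k * d) k ⟩
    k + k * d               ≡⟨ *-suc k d ⟨
    k * suc d               ≡⟨ +-identityʳ _ ⟨
    k * suc d + 0           ∎
    where open ≡-Reasoning

  Changes : ℕ → Set
  Changes v = A (suc v) ≢ A v

  changes-at-block-end : ∀ d → M ≤ k * d + (k ∸ 1) → Changes (k * d + (k ∸ 1)) ⇔ Changes d
  changes-at-block-end d large = mk⇔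
    (λ changes eq → changes (trans end (trans (cong not eq) (sym start))))
    (λ changes eq → changes (Bool.not-injective (trans (sym end) (trans eq start))))
    where
    k∸1<k : k ∸ 1 < k
    k∸1<k = ≤-reflexive (m+[n∸m]≡n {1} k≥1)
    start : A (k * d + (k ∸ 1)) ≡ not (A d)
    start = rule d (k ∸ 1) k∸1<k large
    end : A (suc (k * d + (k ∸ 1))) ≡ not (A (suc d))
    end = rule-at (last-digit d) k≥1 (≤-trans large (n≤1+n _))

  change-descends : ∀ v → M ≤ v → Changes v → ∃[ d ] (suc v ≡ k * suc d × Changes d)
  change-descends v M≤v changes with divide {k} (suc v)
  ... | D , suc j , j<k , eq = ⊥-elim (changes (trans (rule-at eq j<k (≤-trans M≤v (n≤1+n v)))
                                                       (sym (rule-at v≡ (<-trans (n<1+n j) j<k) M≤v))))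
    where
    v≡ : v ≡ k * D + j
    v≡ = suc-injective (trans eq (+-suc (k * D) j))
  ... | zero , zero , _ , eq = ⊥-elim (1+n≢0 (trans eq (cong (_+ 0) (*-zeroʳ k))))
  ... | suc d , zero , _ , eq =
    d , trans eq (+-identityʳ _) , Equivalence.to (changes-at-block-end d (subst (M ≤_) v≡ M≤v)) (subst Changes v≡ changes)
    where
    v≡ : v ≡ k * d + (k ∸ 1)
    v≡ = suc-injective (trans eq (sym (last-digit d)))

  change-ascends : ∀ d → M ≤ d → Changes d → Changes (k * d + (k ∸ 1))
  change-ascends d M≤d = Equivalence.from (changes-at-block-end d (≤-trans M≤d (≤-trans (m≤n*m d k) (m≤m+n _ _))))

  change-exists : ∃[ v ] (M ≤ v × Changes v)
  change-exists = change-between A M (k * M ∸ M) (subst (λ n → A M ≢ A n) (sym M+[kM∸M]) (subst (A M ≢_) (sym flips) (Bool.not-¬ refl)))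
    where
    M+[kM∸M] : M + (k * M ∸ M) ≡ k * M + 0
    M+[kM∸M] = trans (m+[n∸m]≡n (m≤n*m M k)) (sym (+-identityʳ _))
    flips : A (k * M + 0) ≡ not (A M)
    flips = rule M 0 k≥1 (≤-trans (m≤n*m M k) (m≤m+n _ 0))

  -- Descending both changes divides the gap e by k.
  changes-far-apart : ∀ v e → 1 ≤ e → Changes v → Changes (v + e) → suc v ≤ M * e
  changes-far-apart = <-rec _ step
    where
    step : ∀ v → (∀ {u} → u < v → ∀ e → 1 ≤ e → Changes u → Changes (u + e) → suc u ≤ M * e) →
      ∀ e → 1 ≤ e → Changes v → Changes (v + e) → suc v ≤ M * e
    step v ih e 1≤e changes changes′ with suc v ≤? M
    ... | yes small = ≤-trans small (m≤m*n M e {{>-nonZero 1≤e}})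
    ... | no large = descend (change-descends v M≤v changes) (change-descends (v + e) (≤-trans M≤v (m≤m+n v e)) changes′)
      where
      M≤v : M ≤ v
      M≤v = ≤-pred (≰⇒> large)
      descend : ∃[ d ] (suc v ≡ k * suc d × Changes d) → ∃[ d′ ] (suc (v + e) ≡ k * suc d′ × Changes d′) → suc v ≤ M * e
      descend (d , v≡ , cd) (d′ , w≡ , cd′) with m≤n⇒∃[o]m+o≡n d<d′
        where
        d<d′ : d < d′
        d<d′ = ≤-pred (*-cancelˡ-< k (suc d) (suc d′) (begin-strict
          k * suc d       ≡⟨ v≡ ⟨
          suc v           <⟨ s≤s (m<m+n v 1≤e) ⟩
          suc (v + e)     ≡⟨ w≡ ⟩
          k * suc d′      ∎))
          where open ≤-Reasoning
      ... | o , refl = begin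
        suc v               ≡⟨ v≡ ⟩
        k * suc d           ≤⟨ *-monoʳ-≤ k (ih d<v (suc o) (s≤s z≤n) cd (subst Changes (sym (+-suc d o)) cd′)) ⟩
        k * (M * suc o)     ≡⟨ *-comm-middle k M (suc o) ⟩
        M * (k * suc o)     ≡⟨ cong (M *_) e≡ ⟨
        M * e               ∎
        where
        open ≤-Reasoning
        d<v : d < v
        d<v = ≤-pred (subst (suc d <_) (trans (*-comm (suc d) k) (sym v≡)) (m<m*n (suc d) k k≥2))
        e≡ : e ≡ k * suc o
        e≡ = +-cancelˡ-≡ (suc v) e (k * suc o) (begin-equality
          suc v + e                  ≡⟨ +-suc v e ⟨
          v + suc e                  ≡⟨ +-comm v (suc e) ⟩
          suc (e + v)                ≡⟨ cong suc (+-comm e v) ⟩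
          suc (v + e)                ≡⟨ w≡ ⟩
          k * suc (suc d + o)        ≡⟨ cong (k *_) (cong suc (+-suc d o)) ⟨
          k * (suc d + suc o)        ≡⟨ *-distribˡ-+ k (suc d) (suc o) ⟩
          k * suc d + k * suc o      ≡⟨ cong (_+ k * suc o) v≡ ⟨
          suc v + k * suc o          ∎)
        *-comm-middle : ∀ a b c → a * (b * c) ≡ b * (a * c)
        *-comm-middle = solve-∀

  record IsMixed (q a c : ℕ) : Set where
    constructor mixed
    field
      sums-to   : a + c ≡ q
      M≤left    : M ≤ a
      M≤right   : M ≤ c
      differ    : A a ≢ A c

  IsMixed-cast : ∀ {q q′ a c} → q ≡ q′ → IsMixed q a c → IsMixed q′ a c
  IsMixed-cast refl m = m

  IsMixed-sym : ∀ {q a c} → IsMixed q a c → IsMixed q c a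
  IsMixed-sym {a = a} {c} (mixed a+c≡q M≤a M≤c differ) = mixed (trans (+-comm c a) a+c≡q) M≤c M≤a (differ ∘ sym)

  mixed-beyond : ∀ u w → M ≤ u → u < w → Changes u → Changes w →
    ∀ T → M * (w ∸ u) ≤ T → ∃[ a ] ∃[ c ] IsMixed (suc w + T) a c
  mixed-beyond u w M≤u u<w changes changes′ T far =
    pick (A (suc w) Bool.≟ A T) (A w Bool.≟ A (suc T)) (A (suc u) Bool.≟ A (T + e)) (A u Bool.≟ A (suc (T + e)))
    where
    e = w ∸ u
    1≤e : 1 ≤ e
    1≤e = m<n⇒0<n∸m u<w
    M≤w : M ≤ w
    M≤w = ≤-trans M≤u (<⇒≤ u<w)
    M≤T : M ≤ T
    M≤T = ≤-trans (m≤m*n M e {{>-nonZero 1≤e}}) far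
    M≤T+e : M ≤ T + e
    M≤T+e = ≤-trans M≤T (m≤m+n T e)
    u+[T+e]≡w+T : u + (T + e) ≡ w + T
    u+[T+e]≡w+T = begin
      u + (T + e)   ≡⟨ cong (u +_) (+-comm T e) ⟩
      u + (e + T)   ≡⟨ +-assoc u e T ⟨
      u + e + T     ≡⟨ cong (_+ T) (m+[n∸m]≡n (<⇒≤ u<w)) ⟩
      w + T         ∎
      where open ≡-Reasoning
    -- If no candidate pair is mixed, A changes at T and at T + e, which are too close.
    pick : Dec (A (suc w) ≡ A T) → Dec (A w ≡ A (suc T)) → Dec (A (suc u) ≡ A (T + e)) → Dec (A u ≡ A (suc (T + e))) →
      ∃[ a ] ∃[ c ] IsMixed (suc w + T) a c
    pick (no diff) _ _ _ = suc w , T , mixed refl (≤-trans M≤w (n≤1+n w)) M≤T diff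
    pick (yes _) (no diff) _ _ = w , suc T , mixed (+-suc w T) M≤w (≤-trans M≤T (n≤1+n T)) diff
    pick (yes _) (yes _) (no diff) _ = suc u , T + e , mixed (cong suc u+[T+e]≡w+T) (≤-trans M≤u (n≤1+n u)) M≤T+e diff
    pick (yes _) (yes _) (yes _) (no diff) =
      u , suc (T + e) , mixed (trans (+-suc u (T + e)) (cong suc u+[T+e]≡w+T)) M≤u (≤-trans M≤T+e (n≤1+n _)) diff
    pick (yes p) (yes p′) (yes r) (yes r′) = ⊥-elim (<⇒≱ (changes-far-apart T e 1≤e changes-T changes-T+e) far)
      where
      changes-T : Changes T
      changes-T eq = changes′ (trans p (trans (sym eq) (sym p′)))
      changes-T+e : Changes (T + e)
      changes-T+e eq = changes (trans r (trans (sym eq) (sym r′)))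

  mixed-eventually : ∃[ R ] ∀ q → R ≤ q → ∃[ a ] ∃[ c ] IsMixed q a c
  mixed-eventually with change-exists
  ... | u , M≤u , changes = suc w + M * (w ∸ u) , λ q R≤q →
    let w+1≤q = ≤-trans (m≤m+n (suc w) _) R≤q
        q≡ = m+[n∸m]≡n w+1≤q
        (a , c , is-mixed) = mixed-beyond u w M≤u u<w changes (change-ascends u M≤u changes) (q ∸ suc w)
                               (+-cancelˡ-≤ (suc w) _ _ (subst (suc w + M * (w ∸ u) ≤_) (sym q≡) R≤q))
    in a , c , IsMixed-cast q≡ is-mixed
    where
    w = k * u + (k ∸ 1)
    u<w : u < w
    u<w = <-≤-trans (m<m*n u k {{>-nonZero (≤-trans M≥1 M≤u)}} k≥2) (≤-trans (≤-reflexive (*-comm u k)) (m≤m+n _ _))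

  mixed? : ℕ → ℕ → Bool
  mixed? q a = (M ≤ᵇ a) ∧ (a + M ≤ᵇ q) ∧ (A a xor A (q ∸ a))

  mixedCount : ℕ → ℕ
  mixedCount q = ∑[ a < suc q ] 𝟙 (mixed? q a)

  mixed?-sound : ∀ {q a} → T (mixed? q a) → IsMixed q a (q ∸ a)
  mixed?-sound {q} {a} t with Equivalence.to Bool.T-∧ t
  ... | M≤ᵇa , rest with Equivalence.to Bool.T-∧ rest
  ... | a+M≤ᵇq , differ = mixed (m+[n∸m]≡n a≤q) (≤ᵇ⇒≤ M a M≤ᵇa) M≤q∸a (xor⇒≢ differ)
    where
    a+M≤q : a + M ≤ q
    a+M≤q = ≤ᵇ⇒≤ (a + M) q a+M≤ᵇq
    a≤q : a ≤ q
    a≤q = ≤-trans (m≤m+n a M) a+M≤q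
    M≤q∸a : M ≤ q ∸ a
    M≤q∸a = +-cancelˡ-≤ a M (q ∸ a) (≤-trans a+M≤q (≤-reflexive (sym (m+[n∸m]≡n a≤q))))

  mixed?-complete : ∀ {q a c} → IsMixed q a c → T (mixed? q a)
  mixed?-complete {q} {a} {c} (mixed a+c≡q M≤a M≤c differ) =
    Equivalence.from Bool.T-∧ (≤⇒≤ᵇ M≤a , Equivalence.from Bool.T-∧
      (≤⇒≤ᵇ (subst (a + M ≤_) a+c≡q (+-monoʳ-≤ a M≤c)) , ≢⇒xor (subst (λ b → A a ≢ A b) c≡q∸a differ)))
    where
    c≡q∸a : c ≡ q ∸ a
    c≡q∸a = trans (sym (m+n∸m≡n a c)) (cong (_∸ a) a+c≡q)

  mixedCount-top : ∀ q → mixedCount (suc q) ≡ ∑[ a < suc q ] 𝟙 (mixed? (suc q) a)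
  mixedCount-top q = trans (∑-snoc (𝟙 ∘ mixed? (suc q)) (suc q)) (trans (cong (∑[ a < suc q ] 𝟙 (mixed? (suc q) a) +_) not-mixed) (+-identityʳ _))
    where
    not-mixed : 𝟙 (mixed? (suc q) (suc q)) ≡ 0
    not-mixed = 𝟙-≡0 λ t → let M≤0 = IsMixed.M≤right (mixed?-sound {suc q} {suc q} t) in <⇒≱ M≥1 (subst (M ≤_) (n∸n≡0 (suc q)) M≤0)

  IsMixed-lift : ∀ {P z w j j′} → j < k → j′ < k → IsMixed P z w → IsMixed (k * P + (j + j′)) (k * z + j) (k * w + j′)
  IsMixed-lift {P} {z} {w} {j} {j′} j<k j′<k (mixed z+w≡P M≤z M≤w differ) =
    mixed sum M≤kz+j M≤kw+j′ λ eq → differ (Bool.not-injective (trans (sym (rule z j j<k M≤kz+j)) (trans eq (rule w j′ j′<k M≤kw+j′))))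
    where
    M≤kz+j : M ≤ k * z + j
    M≤kz+j = ≤-trans (≤-trans M≤z (m≤n*m z k)) (m≤m+n _ j)
    M≤kw+j′ : M ≤ k * w + j′
    M≤kw+j′ = ≤-trans (≤-trans M≤w (m≤n*m w k)) (m≤m+n _ j′)
    digits-+ : ∀ k z w j j′ → k * z + j + (k * w + j′) ≡ k * (z + w) + (j + j′)
    digits-+ = solve-∀
    sum : k * z + j + (k * w + j′) ≡ k * P + (j + j′)
    sum = trans (digits-+ k z w j j′) (cong (λ p → k * p + (j + j′)) z+w≡P)

  -- Last digits with j + j′ = s lift pairs for Q + 1; those with j + j′ = k + s, carrying one, lift pairs for Q.
  mixed-block : ∀ Q s t → suc s + t ≡ k → ∀ z →
    suc s * 𝟙 (mixed? (suc Q) z) + t * 𝟙 (mixed? Q z) ≤ ∑[ j < k ] 𝟙 (mixed? (k * suc Q + s) (k * z + j))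
  mixed-block Q s t t-split z = begin
    suc s * 𝟙 (mixed? (suc Q) z) + t * 𝟙 (mixed? Q z)
      ≡⟨ cong₂ _+_ (∑-const (𝟙 (mixed? (suc Q) z)) (suc s)) (∑-const (𝟙 (mixed? Q z)) t) ⟨
    ∑[ _ < suc s ] 𝟙 (mixed? (suc Q) z) + ∑[ _ < t ] 𝟙 (mixed? Q z)
      ≤⟨ +-mono-≤ (∑-mono-≤ (suc s) (λ j j≤s → 𝟙-mono (no-carry j (≤-pred j≤s))))
                  (∑-mono-≤ t (λ j j<t → 𝟙-mono (carry j j<t))) ⟩
    ∑[ j < suc s ] 𝟙 (mixed? n (k * z + j)) + ∑[ j < t ] 𝟙 (mixed? n (k * z + (suc s + j)))
      ≡⟨ ∑-++ (λ j → 𝟙 (mixed? n (k * z + j))) (suc s) t ⟨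
    ∑[ j < suc s + t ] 𝟙 (mixed? n (k * z + j))
      ≡⟨ cong (λ m → ∑[ j < m ] 𝟙 (mixed? n (k * z + j))) t-split ⟩
    ∑[ j < k ] 𝟙 (mixed? n (k * z + j))  ∎
    where
    open ≤-Reasoning
    n = k * suc Q + s
    s<k : s < k
    s<k = ≤-trans (s≤s (m≤m+n s t)) (≤-reflexive t-split)
    no-carry : ∀ j → j ≤ s → T (mixed? (suc Q) z) → T (mixed? n (k * z + j))
    no-carry j j≤s is-mixed = mixed?-complete (IsMixed-cast (cong (k * suc Q +_) (m+[n∸m]≡n j≤s))
      (IsMixed-lift (≤-<-trans j≤s s<k) (≤-<-trans (m∸n≤m s j) s<k) (mixed?-sound is-mixed)))
    carry : ∀ j → j < t → T (mixed? Q z) → T (mixed? n (k * z + (suc s + j)))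
    carry j j<t is-mixed with m≤n⇒∃[o]m+o≡n j<t
    ... | o , refl = mixed?-complete (IsMixed-cast total (IsMixed-lift j₁<k j₂<k (mixed?-sound is-mixed)))
      where
      j₁<k : suc s + j < k
      j₁<k = <-≤-trans (+-monoʳ-< (suc s) (m<m+n j {suc o} (s≤s z≤n))) (≤-reflexive (trans (cong (suc s +_) (+-suc j o)) t-split))
      j₂<k : s + suc o < k
      j₂<k = ≤-trans (s≤s (+-monoʳ-≤ s (s≤s (m≤n+m o j)))) (≤-reflexive t-split)
      carry-digits : ∀ s j o Q → (suc s + (suc j + o)) * Q + (suc s + j + (s + suc o)) ≡ (suc s + (suc j + o)) * suc Q + s
      carry-digits = solve-∀
      total : k * Q + (suc s + j + (s + suc o)) ≡ n
      total = subst (λ K → K * Q + (suc s + j + (s + suc o)) ≡ K * suc Q + s) t-split (carry-digits s j o Q)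

  mixedCount-rec : ∀ Q s t → suc s + t ≡ k → suc s * mixedCount (suc Q) + t * mixedCount Q ≤ mixedCount (k * suc Q + s)
  mixedCount-rec Q s t t-split = begin
    suc s * mixedCount (suc Q) + t * mixedCount Q
      ≡⟨ cong (λ x → suc s * x + t * mixedCount Q) (mixedCount-top Q) ⟩
    suc s * ∑[ z < suc Q ] x z + t * ∑[ z < suc Q ] y z
      ≡⟨ cong₂ _+_ (∑-*ˡ (suc s) x (suc Q)) (∑-*ˡ t y (suc Q)) ⟨
    ∑[ z < suc Q ] (suc s * x z) + ∑[ z < suc Q ] (t * y z)
      ≡⟨ ∑-distrib-+ (λ z → suc s * x z) (λ z → t * y z) (suc Q) ⟨
    ∑[ z < suc Q ] (suc s * x z + t * y z)
      ≤⟨ ∑-mono-≤ (suc Q) (λ z _ → mixed-block Q s t t-split z) ⟩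
    ∑[ z < suc Q ] ∑[ j < k ] 𝟙 (mixed? n (k * z + j))
      ≡⟨ ∑-blocks (𝟙 ∘ mixed? n) k (suc Q) ⟨
    ∑[ a < k * suc Q ] 𝟙 (mixed? n a)
      ≤⟨ ∑-mono-range (𝟙 ∘ mixed? n) (≤-trans (m≤m+n (k * suc Q) s) (n≤1+n n)) ⟩
    mixedCount n  ∎
    where
    open ≤-Reasoning
    n = k * suc Q + s
    x y : ℕ → ℕ
    x z = 𝟙 (mixed? (suc Q) z)
    y z = 𝟙 (mixed? Q z)

  mixedCount-eventually-positive : ∃[ R ] ∀ q → R ≤ q → 1 ≤ mixedCount q
  mixedCount-eventually-positive with mixed-eventually
  ... | R , has-mixed = R , λ q R≤q → let (a , c , is-mixed) = has-mixed q R≤q in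
    ∑-positive (𝟙 ∘ mixed? q) a (s≤s (subst (a ≤_) (IsMixed.sums-to is-mixed) (m≤m+n a c)))
      (𝟙-mono {true} (λ _ → mixed?-complete is-mixed))

  mixed-represented : ∀ {q s a c} → s < k → IsMixed q a c → T (A a) → T (A a ∧ A (k * q + s ∸ k * a))
  mixed-represented {q} {s} {a} {c} s<k (mixed a+c≡q M≤a M≤c differ) Aa =
    Equivalence.from Bool.T-∧ (Aa , subst T (sym partner-in-A) Aa)
    where
    digits-+ : ∀ k a c s → k * (a + c) + s ≡ k * a + (k * c + s)
    digits-+ = solve-∀
    partner : k * q + s ∸ k * a ≡ k * c + s
    partner = begin
      k * q + s ∸ k * a               ≡⟨ cong (λ p → k * p + s ∸ k * a) a+c≡q ⟨
      k * (a + c) + s ∸ k * a         ≡⟨ cong (_∸ k * a) (digits-+ k a c s) ⟩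
      k * a + (k * c + s) ∸ k * a     ≡⟨ m+n∸m≡n (k * a) (k * c + s) ⟩
      k * c + s                       ∎
      where open ≡-Reasoning
    partner-in-A : A (k * q + s ∸ k * a) ≡ A a
    partner-in-A = begin
      A (k * q + s ∸ k * a)   ≡⟨ cong A partner ⟩
      A (k * c + s)           ≡⟨ rule c s s<k (≤-trans (≤-trans M≤c (m≤n*m c k)) (m≤m+n _ s)) ⟩
      not (A c)               ≡⟨ cong not (Bool.¬-not (differ ∘ sym)) ⟩
      not (not (A a))         ≡⟨ Bool.not-involutive (A a) ⟩
      A a                     ∎
      where open ≡-Reasoning

  mixedCount≤2*r1k : ∀ {s} → s < k → ∀ q → mixedCount q ≤ 2 * r1k k A (k * q + s)
  mixedCount≤2*r1k {s} s<k q = begin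
    mixedCount q                                 ≤⟨ ∑-mono-≤ (suc q) (λ a _ → mixed≤represented a) ⟩
    ∑[ a < suc q ] (g a + g (q ∸ a))             ≡⟨ ∑-distrib-+ g (λ a → g (q ∸ a)) (suc q) ⟩
    ∑ (suc q) g + ∑[ a < suc q ] g (q ∸ a)       ≡⟨ cong (∑ (suc q) g +_) (∑-reverse g q) ⟩
    ∑ (suc q) g + ∑ (suc q) g                    ≡⟨ cong (∑ (suc q) g +_) (+-identityʳ _) ⟨
    2 * ∑ (suc q) g                              ≡⟨ cong (2 *_) (r1k-digits s<k A q) ⟨
    2 * r1k k A (k * q + s)                      ∎
    where
    open ≤-Reasoning
    g : ℕ → ℕ
    g a = 𝟙 (A a ∧ A (k * q + s ∸ k * a))
    mixed≤represented : ∀ a → 𝟙 (mixed? q a) ≤ g a + g (q ∸ a)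
    mixed≤represented a with T? (mixed? q a)
    ... | no ¬mixed = subst (_≤ g a + g (q ∸ a)) (sym (𝟙-≡0 ¬mixed)) z≤n
    ... | yes is-mixed with ≢⇒T⊎T (IsMixed.differ (mixed?-sound is-mixed))
    ... | inj₁ Aa = ≤-trans (𝟙-mono (λ _ → mixed-represented s<k (mixed?-sound is-mixed) Aa)) (m≤m+n _ _)
    ... | inj₂ Ac = ≤-trans (𝟙-mono (λ _ → mixed-represented s<k (IsMixed-sym (mixed?-sound is-mixed)) Ac)) (m≤n+m _ _)

theorem1p1 : (k : ℕ) → 2 ≤ k → (A : Subset) →
    (∃[ N₀ ] ∀ n → n ≥ N₀ → r1k k A n ≡ r1k k (complement A) n) →
    ∃[ m ] (1 ≤ m × ∃[ N ] ∀ n → n ≥ N → n ≤ m * r1k k A n)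
theorem1p1 k k≥2 A (N₀ , balanced) =
  k * (C * 2) , 1≤m , k * R , digitwise⇒linear (r1k k A) (C * 2) R bound
  where
  k≥1 : 1 ≤ k
  k≥1 = ≤-trans (s≤s z≤n) k≥2
  instance
    k-nonZero : NonZero k
    k-nonZero = >-nonZero k≥1
  open DigitRuleConsequences k≥2 (≤-trans k≥1 (m≤n+m k N₀)) (balanced⇒digit-rule A N₀ balanced)
  R = proj₁ mixedCount-eventually-positive
  C = k * suc R
  bound : ∀ q s → s < k → R ≤ q → suc q ≤ C * 2 * r1k k A (k * q + s)
  bound q s s<k R≤q = begin
    suc q                          ≤⟨ linear-growth k≥2 mixedCount R (proj₂ mixedCount-eventually-positive) mixedCount-rec q R≤q ⟩
    C * mixedCount q               ≤⟨ *-monoʳ-≤ C (mixedCount≤2*r1k s<k q) ⟩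
    C * (2 * r1k k A (k * q + s))  ≡⟨ *-assoc C 2 _ ⟨
    C * 2 * r1k k A (k * q + s)    ∎
    where open ≤-Reasoning
  1≤m : 1 ≤ k * (C * 2)
  1≤m = ≤-trans k≥1 (m≤m*n k (C * 2) {{m*n≢0 C 2 {{m*n≢0 k (suc R)}}}})
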